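{- Every odd 4-multipede is rigid (has no automorphism other than the identity).
   Context: All structures are finite. A 2-multipede is a structure $(U_0,E,T)$ where: $(U_0,E)$ is a directed graph with $D(E)\cap R(E)=\emptyset$, $D(E)\cup R(E)=U_0$ ($D(E)$ = domain, $R(E)$ = range of $E$), each element of $D(E)$ (a foot) has exactly one outgoing edge, each element of $R(E)$ (a segment) has exactly two incoming edges; $S(a)$ denotes the segment of a foot $a$ and $S(y)=y$ for segments; $T$ is a set of 3-element subsets (hyperedges) each consisting entirely of segments or entirely of feet, with $S(h)\in T$ for every foot hyperedge $h$; and for each segment hyperedge $X$, among the 3-element foot sets $A$ with $S(A)=X$ (slaves; positive if $A\in T$) exactly four are positive and they are pairwise equivalent, two slaves being equivalent if equal or one is obtained from the other by swapping the feet of exactly two segments. A 3-multipede is a 2-multipede with a linear order $<$ on the segments. A 4-multipede is a structure $(U,E,T,<,\in)$ whose universe is the disjoint union of $U_0$ and a set $\Sigma$ of super-segments, where $(U_0,E,T,<)$ is a 3-multipede, $E,T,<$ involve only elements of $U_0$, $\in$ relates segments to super-segments, and $\sigma\mapsto\{x:x\in\sigma\}$ is a bijection from $\Sigma$ onto the set of all sets of segments. It is odd if for every nonempty set $X$ of segments some segment hyperedge $h$ has $|h\cap X|$ odd. -}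

module Defs where

open import Data.Nat using (ℕ; _%_)
open import Data.Bool using (Bool; true; false; _∧_; _∨_; _xor_; not)
open import Data.Fin using (Fin)
open import Data.Fin.Subset using (Subset; ∣_∣; _∩_; Nonempty)
open import Data.Vec using (lookup; tabulate)
open import Data.List using (allFin)
open import Data.Bool.ListAction using (any)
open import Data.Product using (Σ; ∃; _×_; _,_)
open import Data.Sum using (_⊎_)
open import Data.Empty using (⊥)
open import Relation.Nullary using (¬_)
open import Relation.Binary.PropositionalEquality using (_≡_; _≢_)
open import Data.Fin.Permutation using (Permutation′; _⟨$⟩ʳ_; _⟨$⟩ˡ_)

-- All relations are Boolean-valued (structures are finite, so this is
-- the usual classical reading).
--   E   x y : there is an edge x → y
--   T   h   : the subset h of U is a hyperedge
--   Lt  x y : x < y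
--   Mem x σ : x ∈ σ
record Structure (n : ℕ) : Set where
  field
    E   : Fin n → Fin n → Bool
    T   : Subset n → Bool
    Lt  : Fin n → Fin n → Bool
    Mem : Fin n → Fin n → Bool

module _ {n : ℕ} (M : Structure n) where
  open Structure M

  Foot : Fin n → Set
  Foot x = ∃ λ y → E x y ≡ true

  Segment : Fin n → Set
  Segment y = ∃ λ x → E x y ≡ true

  InU0 : Fin n → Set
  InU0 x = Foot x ⊎ Segment x

  _∈ₛ_ : Fin n → Subset n → Set
  x ∈ₛ A = lookup A x ≡ true

  AllSegments : Subset n → Set
  AllSegments A = ∀ x → x ∈ₛ A → Segment x

  AllFeet : Subset n → Set
  AllFeet A = ∀ x → x ∈ₛ A → Foot x

  SImage : Subset n → Subset n
  SImage A = tabulate λ y → any (λ x → lookup A x ∧ E x y) (allFin n)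

  Hyperedge : Subset n → Set
  Hyperedge h = T h ≡ true

  SegmentHyperedge : Subset n → Set
  SegmentHyperedge h = Hyperedge h × AllSegments h

  FootHyperedge : Subset n → Set
  FootHyperedge h = Hyperedge h × AllFeet h

  Slave : Subset n → Subset n → Set
  Slave X A = (∣ A ∣ ≡ 3) × AllFeet A × (SImage A ≡ X)

  SwapTwo : Subset n → Subset n → Set
  SwapTwo A B = Σ (Fin n) λ y₁ → Σ (Fin n) λ y₂ →
    Segment y₁ × Segment y₂ × (y₁ ≢ y₂) ×
    (∀ x → lookup B x ≡ (lookup A x xor (E x y₁ ∨ E x y₂)))

  SlaveEquiv : Subset n → Subset n → Set
  SlaveEquiv A B = (A ≡ B) ⊎ SwapTwo A B

  record Is2Multipede : Set where
    field
      dom-ran-disjoint : ∀ x → ¬ (Foot x × Segment x)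
      foot-one-edge    : ∀ x y z → E x y ≡ true → E x z ≡ true → y ≡ z
      segment-two-feet : ∀ y → Segment y →
        Σ (Fin n) λ a → Σ (Fin n) λ b → (a ≢ b) × E a y ≡ true × E b y ≡ true ×
          (∀ c → E c y ≡ true → (c ≡ a) ⊎ (c ≡ b))
      hyperedge-shape  : ∀ h → Hyperedge h →
        (∣ h ∣ ≡ 3) × (AllSegments h ⊎ AllFeet h)
      foot-hyperedge-S : ∀ h → FootHyperedge h → Hyperedge (SImage h)
      four-positive    : ∀ X → SegmentHyperedge X →
        Σ (Subset n) λ A₁ → Σ (Subset n) λ A₂ → Σ (Subset n) λ A₃ → Σ (Subset n) λ A₄ →
          (Slave X A₁ × Hyperedge A₁) × (Slave X A₂ × Hyperedge A₂) ×
          (Slave X A₃ × Hyperedge A₃) × (Slave X A₄ × Hyperedge A₄) ×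
          (A₁ ≢ A₂) × (A₁ ≢ A₃) × (A₁ ≢ A₄) × (A₂ ≢ A₃) × (A₂ ≢ A₄) × (A₃ ≢ A₄) ×
          (∀ A → Slave X A → Hyperedge A →
             (A ≡ A₁) ⊎ (A ≡ A₂) ⊎ (A ≡ A₃) ⊎ (A ≡ A₄))
      positive-equiv   : ∀ X → SegmentHyperedge X → ∀ A B →
        Slave X A → Hyperedge A → Slave X B → Hyperedge B → SlaveEquiv A B

  record Is3Multipede : Set where
    field
      is2         : Is2Multipede
      lt-segments : ∀ x y → Lt x y ≡ true → Segment x × Segment y
      lt-irrefl   : ∀ x → ¬ (Lt x x ≡ true)
      lt-trans    : ∀ x y z → Lt x y ≡ true → Lt y z ≡ true → Lt x z ≡ true
      lt-total    : ∀ x y → Segment x → Segment y →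
        (Lt x y ≡ true) ⊎ (x ≡ y) ⊎ (Lt y x ≡ true)

  -- 4-multipede: universe = U₀ ⊎ Σ, where Σ = U ∖ U₀ are the super-segments
  record Is4Multipede : Set where
    field
      is3          : Is3Multipede
      mem-typed    : ∀ x σ → Mem x σ ≡ true → Segment x × ¬ InU0 σ
      mem-injective : ∀ σ τ → ¬ InU0 σ → ¬ InU0 τ →
        (∀ x → Mem x σ ≡ Mem x τ) → σ ≡ τ
      mem-surjective : ∀ X → AllSegments X →
        Σ (Fin n) λ σ → ¬ InU0 σ × (∀ x → Mem x σ ≡ lookup X x)

  Odd : Set
  Odd = ∀ X → AllSegments X → Nonempty X →
    Σ (Subset n) λ h → SegmentHyperedge h × (∣ h ∩ X ∣ % 2 ≡ 1)

imageₛ : {n : ℕ} → Permutation′ n → Subset n → Subset n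
imageₛ π A = tabulate λ j → lookup A (π ⟨$⟩ˡ j)

IsAutomorphism : {n : ℕ} → Structure n → Permutation′ n → Set
IsAutomorphism {n} M π =
  (∀ x y → E (π ⟨$⟩ʳ x) (π ⟨$⟩ʳ y) ≡ E x y) ×
  (∀ h → T (imageₛ π h) ≡ T h) ×
  (∀ x y → Lt (π ⟨$⟩ʳ x) (π ⟨$⟩ʳ y) ≡ Lt x y) ×
  (∀ x y → Mem (π ⟨$⟩ʳ x) (π ⟨$⟩ʳ y) ≡ Mem x y)
  where open Structure M

Rigid : {n : ℕ} → Structure n → Set
Rigid {n} M = ∀ (π : Permutation′ n) → IsAutomorphism M π → ∀ x → π ⟨$⟩ʳ x ≡ x

{-# OPTIONS --safe #-}

-- An automorphism π preserves the linear order of the segments, and an order-preserving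
-- self-map of a finite chain moves no point (otherwise some orbit would ascend forever),
-- so π fixes every segment and hence permutes the two feet of each segment. Let Moved be
-- the set of segments whose feet π swaps. If A is a positive slave of a segment hyperedge
-- X, then so is π A; hence π A = A or π A arises from A by swapping the feet of two
-- segments. As A and π A differ exactly at the segments in X ∩ Moved, |X ∩ Moved| is 0
-- or 2, so oddness forces Moved = ∅: π fixes all feet. Finally π fixes each
-- super-segment, since it fixes all of its members.

module Submission where

open import Defs
open import Data.Bool using (Bool; true; false; _∧_; _∨_; _xor_; not)
import Data.Bool as Bool
open import Data.Bool.Properties using (T-≡; xor-comm; ∨-zeroʳ; ¬-not; not-¬; not-injective)
open import Data.Bool.ListAction using (any)
open import Data.Empty using (⊥-elim)
open import Data.Fin using (Fin; zero; suc; toℕ; _≟_)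
open import Data.Fin.Permutation using (Permutation′; _⟨$⟩ʳ_; _⟨$⟩ˡ_; inverseʳ; inverseˡ)
open import Data.Fin.Properties using (any?; pigeonhole)
open import Data.Fin.Subset
open import Data.Fin.Subset.Properties
open import Data.List using (allFin)
open import Data.List.Membership.Propositional using (lose)
open import Data.List.Membership.Propositional.Properties using (∈-allFin)
open import Data.List.Relation.Unary.Any using (satisfied)
open import Data.List.Relation.Unary.Any.Properties using (any⁺; any⁻)
open import Data.Nat using (ℕ; zero; suc; _+_; _≤_; _<_; z≤n; s≤s; _%_)
import Data.Nat.Properties as ℕ
open import Data.Nat.GeneralisedArithmetic using (fold)
open import Data.Product using (∃; ∃₂; _×_; _,_; proj₁; proj₂)
open import Data.Sum using (_⊎_; inj₁; inj₂)
import Data.Sum as Sum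
open import Data.Vec using ([]; _∷_; here; there; lookup; tabulate)
open import Data.Vec.Properties using (lookup∘tabulate; []=⇒lookup; lookup⇒[]=)
open import Function.Base using (_∘_; flip)
open import Function.Bundles using (Equivalence; Injection)
open import Function.Properties.Inverse using (↔⇒↣)
open import Level using (0ℓ)
open import Relation.Binary.Core using (Rel)
open import Relation.Binary.Definitions using (Transitive; Irreflexive)
open import Relation.Binary.PropositionalEquality
open import Relation.Nullary using (¬_; yes; no; Dec)
open import Relation.Nullary.Decidable
  using (_⊎-dec_; isNo; decidable-stable; toWitnessFalse; fromWitnessFalse)

∧-true⁻ : ∀ {a b} → a ∧ b ≡ true → a ≡ true × b ≡ true
∧-true⁻ {true} {true} _ = refl , refl

∨-true⁻ : ∀ {a b} → a ∨ b ≡ true → a ≡ true ⊎ b ≡ true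
∨-true⁻ {true} _ = inj₁ refl
∨-true⁻ {false} b = inj₂ b

≡-by-true-cases : ∀ {a b} → (a ≡ true → a ≡ b) → (b ≡ true → a ≡ b) → a ≡ b
≡-by-true-cases {true} a⇒ _ = a⇒ refl
≡-by-true-cases {false} {true} _ b⇒ = b⇒ refl
≡-by-true-cases {false} {false} _ _ = refl

any-allFin⁺ : ∀ {n} (f : Fin n → Bool) {x} → f x ≡ true → any f (allFin n) ≡ true
any-allFin⁺ f {x} fx = Equivalence.to T-≡ (any⁺ f (lose (∈-allFin x) (Equivalence.from T-≡ fx)))

any-allFin⁻ : ∀ {n} (f : Fin n → Bool) → any f (allFin n) ≡ true → ∃ λ x → f x ≡ true
any-allFin⁻ {n} f some with x , fx ← satisfied (any⁻ f (allFin n) (Equivalence.from T-≡ some)) =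
  x , Equivalence.to T-≡ fx

∣p∪q∣≤∣p∣+∣q∣ : ∀ {n} (p q : Subset n) → ∣ p ∪ q ∣ ≤ ∣ p ∣ + ∣ q ∣
∣p∪q∣≤∣p∣+∣q∣ [] [] = z≤n
∣p∪q∣≤∣p∣+∣q∣ (outside ∷ p) (outside ∷ q) = ∣p∪q∣≤∣p∣+∣q∣ p q
∣p∪q∣≤∣p∣+∣q∣ (outside ∷ p) (inside ∷ q) =
  ℕ.≤-trans (s≤s (∣p∪q∣≤∣p∣+∣q∣ p q)) (ℕ.≤-reflexive (sym (ℕ.+-suc ∣ p ∣ ∣ q ∣)))
∣p∪q∣≤∣p∣+∣q∣ (inside ∷ p) (s ∷ q) =
  s≤s (ℕ.≤-trans (∣p∪q∣≤∣p∣+∣q∣ p q) (ℕ.+-monoʳ-≤ ∣ p ∣ (∣p∣≤∣x∷p∣ s q)))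

∣⁅x⁆∪⁅y⁆∣≡2 : ∀ {n} {x y : Fin n} → x ≢ y → ∣ ⁅ x ⁆ ∪ ⁅ y ⁆ ∣ ≡ 2
∣⁅x⁆∪⁅y⁆∣≡2 {x = zero} {zero} x≢y = ⊥-elim (x≢y refl)
∣⁅x⁆∪⁅y⁆∣≡2 {x = zero} {suc y} _ =
  cong suc (trans (cong ∣_∣ (∪-identityˡ ⁅ y ⁆)) (∣⁅x⁆∣≡1 y))
∣⁅x⁆∪⁅y⁆∣≡2 {x = suc x} {zero} _ =
  cong suc (trans (cong ∣_∣ (∪-identityʳ ⁅ x ⁆)) (∣⁅x⁆∣≡1 x))
∣⁅x⁆∪⁅y⁆∣≡2 {x = suc x} {suc y} x≢y = ∣⁅x⁆∪⁅y⁆∣≡2 (x≢y ∘ cong suc)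

image : ∀ {m n} → (Fin m → Fin n) → Subset m → Subset n
image f [] = ⊥
image f (outside ∷ p) = image (f ∘ suc) p
image f (inside ∷ p) = ⁅ f zero ⁆ ∪ image (f ∘ suc) p

∈-image⁺ : ∀ {m n} (f : Fin m → Fin n) {p x} → x ∈ p → f x ∈ image f p
∈-image⁺ f {inside ∷ p} here = p⊆p∪q (image (f ∘ suc) p) (x∈⁅x⁆ (f zero))
∈-image⁺ f {outside ∷ p} (there x∈p) = ∈-image⁺ (f ∘ suc) x∈p
∈-image⁺ f {inside ∷ p} (there x∈p) = q⊆p∪q ⁅ f zero ⁆ _ (∈-image⁺ (f ∘ suc) x∈p)

∣image∣≤∣p∣ : ∀ {m n} (f : Fin m → Fin n) p → ∣ image f p ∣ ≤ ∣ p ∣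
∣image∣≤∣p∣ {n = n} f [] = ℕ.≤-reflexive (∣⊥∣≡0 n)
∣image∣≤∣p∣ f (outside ∷ p) = ∣image∣≤∣p∣ (f ∘ suc) p
∣image∣≤∣p∣ f (inside ∷ p) = begin
  ∣ ⁅ f zero ⁆ ∪ image (f ∘ suc) p ∣        ≤⟨ ∣p∪q∣≤∣p∣+∣q∣ ⁅ f zero ⁆ _ ⟩
  ∣ ⁅ f zero ⁆ ∣ + ∣ image (f ∘ suc) p ∣   ≡⟨ cong (_+ ∣ image (f ∘ suc) p ∣) (∣⁅x⁆∣≡1 (f zero)) ⟩
  suc ∣ image (f ∘ suc) p ∣                 ≤⟨ s≤s (∣image∣≤∣p∣ (f ∘ suc) p) ⟩
  suc ∣ p ∣                                 ∎
  where open ℕ.≤-Reasoning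

module _ {n ℓ} {_≺_ : Rel (Fin n) ℓ} (≺-trans : Transitive _≺_) (≺-irrefl : Irreflexive _≡_ _≺_)
         (f : Fin n → Fin n) (f-mono : ∀ {a b} → a ≺ b → f a ≺ f b) where

  ¬x≺fx : ∀ x → ¬ (x ≺ f x)
  ¬x≺fx x x≺fx = orbit-repeats (pigeonhole (ℕ.n<1+n n) (orbit ∘ toℕ))
    where
    orbit : ℕ → Fin n
    orbit = fold x f

    step : ∀ k → orbit k ≺ orbit (suc k)
    step zero = x≺fx
    step (suc k) = f-mono (step k)

    ascending : ∀ {i j} → i < j → orbit i ≺ orbit j
    ascending {i} {suc j} i<1+j with ℕ.m<1+n⇒m<n∨m≡n i<1+j
    ... | inj₁ i<j = ≺-trans (ascending i<j) (step j)
    ... | inj₂ refl = step i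

    orbit-repeats : ¬ (∃₂ λ (i j : Fin (suc n)) → toℕ i < toℕ j × orbit (toℕ i) ≡ orbit (toℕ j))
    orbit-repeats (i , j , i<j , fⁱx≡fʲx) = ≺-irrefl fⁱx≡fʲx (ascending i<j)

module _ {n} (π : Permutation′ n) where

  ⟨$⟩ʳ-injective : ∀ {x y} → π ⟨$⟩ʳ x ≡ π ⟨$⟩ʳ y → x ≡ y
  ⟨$⟩ʳ-injective = Injection.injective (↔⇒↣ π)

  ∈-imageₛ⁺ : ∀ A {x} → x ∈ A → π ⟨$⟩ʳ x ∈ imageₛ π A
  ∈-imageₛ⁺ A {x} x∈A = lookup⇒[]= _ (imageₛ π A)
    (trans (lookup∘tabulate _ (π ⟨$⟩ʳ x)) (trans (cong (lookup A) (inverseˡ π)) ([]=⇒lookup x∈A)))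

  ∈-imageₛ⁻ : ∀ A {x} → x ∈ imageₛ π A → π ⟨$⟩ˡ x ∈ A
  ∈-imageₛ⁻ A {x} x∈πA = lookup⇒[]= _ A (trans (sym (lookup∘tabulate _ x)) ([]=⇒lookup x∈πA))

  ∣imageₛ∣≡∣p∣ : ∀ A → ∣ imageₛ π A ∣ ≡ ∣ A ∣
  ∣imageₛ∣≡∣p∣ A = ℕ.≤-antisym
    (ℕ.≤-trans (p⊆q⇒∣p∣≤∣q∣ πA⊆) (∣image∣≤∣p∣ (π ⟨$⟩ʳ_) A))
    (ℕ.≤-trans (p⊆q⇒∣p∣≤∣q∣ A⊆) (∣image∣≤∣p∣ (π ⟨$⟩ˡ_) (imageₛ π A)))
    where
    πA⊆ : imageₛ π A ⊆ image (π ⟨$⟩ʳ_) A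
    πA⊆ x∈πA = subst (_∈ image (π ⟨$⟩ʳ_) A) (inverseʳ π)
                 (∈-image⁺ (π ⟨$⟩ʳ_) (∈-imageₛ⁻ A x∈πA))
    A⊆ : A ⊆ image (π ⟨$⟩ˡ_) (imageₛ π A)
    A⊆ x∈A = subst (_∈ image (π ⟨$⟩ˡ_) (imageₛ π A)) (inverseˡ π)
               (∈-image⁺ (π ⟨$⟩ˡ_) (∈-imageₛ⁺ A x∈A))

module _ {n} (M : Structure n) where
  open Structure M

  ∈-SImage⁺ : ∀ {A c y} → c ∈ A → E c y ≡ true → y ∈ SImage M A
  ∈-SImage⁺ {A} {c} {y} c∈A cy = lookup⇒[]= y (SImage M A)
    (trans (lookup∘tabulate _ y)
           (any-allFin⁺ (λ x → lookup A x ∧ E x y) (cong₂ _∧_ ([]=⇒lookup c∈A) cy)))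

  ∈-SImage⁻ : ∀ A {y} → y ∈ SImage M A → ∃ λ c → c ∈ A × E c y ≡ true
  ∈-SImage⁻ A {y} y∈SA =
    let c , Ac∧Ecy = any-allFin⁻ _ (trans (sym (lookup∘tabulate _ y)) ([]=⇒lookup y∈SA))
        Ac , Ecy = ∧-true⁻ Ac∧Ecy
    in c , lookup⇒[]= c A Ac , Ecy

  InU0? : ∀ x → Dec (InU0 M x)
  InU0? x = any? (λ y → E x y Bool.≟ true) ⊎-dec any? (λ y → E y x Bool.≟ true)

  slave-foot : ∀ {X A y} → Slave M X A → y ∈ X → ∃ λ c → c ∈ A × E c y ≡ true
  slave-foot {A = A} (_ , _ , SA≡X) y∈X = ∈-SImage⁻ A (subst (_ ∈_) (sym SA≡X) y∈X)

  slave-segment : ∀ {X A c y} → Slave M X A → c ∈ A → E c y ≡ true → y ∈ X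
  slave-segment (_ , _ , SA≡X) c∈A Ecy = subst (_ ∈_) SA≡X (∈-SImage⁺ c∈A Ecy)

module _ {n} {M : Structure n} (M2 : Is2Multipede M) where
  open Structure M
  open Is2Multipede M2

  feet-of-segment : ∀ {a b c y} → E a y ≡ true → E b y ≡ true → a ≢ b →
                    E c y ≡ true → c ≡ a ⊎ c ≡ b
  feet-of-segment {a} {b} {c} {y} Eay Eby a≢b Ecy
    with _ , _ , _ , _ , _ , only ← segment-two-feet y (a , Eay)
    with only a Eay | only b Eby
  ... | inj₁ refl | inj₁ refl = ⊥-elim (a≢b refl)
  ... | inj₂ refl | inj₂ refl = ⊥-elim (a≢b refl)
  ... | inj₁ refl | inj₂ refl = only c Ecy
  ... | inj₂ refl | inj₁ refl = Sum.swap (only c Ecy)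

  segment-of : Fin n → Fin n
  segment-of x with any? (λ y → E x y Bool.≟ true)
  ... | yes (y , _) = y
  ... | no _ = x

  segment-of-spec : ∀ {x y} → E x y ≡ true → segment-of x ≡ y
  segment-of-spec {x} {y} Exy with any? (λ y → E x y Bool.≟ true)
  ... | yes (y′ , Exy′) = foot-one-edge x y′ y Exy′ Exy
  ... | no no-segment = ⊥-elim (no-segment (y , Exy))

  SImage-injective : ∀ {A c d y} → ∣ A ∣ ≤ ∣ SImage M A ∣ → c ∈ A → d ∈ A →
                     E c y ≡ true → E d y ≡ true → c ≡ d
  SImage-injective {A} {c} {d} {y} ∣A∣≤∣SA∣ c∈A d∈A Ecy Edy =
    decidable-stable (c ≟ d) λ c≢d → ℕ.<-irrefl refl (begin-strict
      ∣ A ∣                            ≤⟨ ∣A∣≤∣SA∣ ⟩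
      ∣ SImage M A ∣                   ≤⟨ p⊆q⇒∣p∣≤∣q∣ (covered c≢d) ⟩
      ∣ image segment-of (A - d) ∣     ≤⟨ ∣image∣≤∣p∣ segment-of (A - d) ⟩
      ∣ A - d ∣                        <⟨ x∈p⇒∣p-x∣<∣p∣ {p = A} d∈A ⟩
      ∣ A ∣                            ∎)
    where
    open ℕ.≤-Reasoning
    covered : c ≢ d → SImage M A ⊆ image segment-of (A - d)
    covered c≢d {z} z∈SA with c′ , c′∈A , Ec′z ← ∈-SImage⁻ M A z∈SA with c′ ≟ d
    ... | yes refl = subst (_∈ image segment-of (A - d))
                       (trans (segment-of-spec Ecy) (foot-one-edge d y z Edy Ec′z))
                       (∈-image⁺ segment-of (x∈p∧x≢y⇒x∈p-y {p = A} c∈A c≢d))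
    ... | no c′≢d = subst (_∈ image segment-of (A - d)) (segment-of-spec Ec′z)
                      (∈-image⁺ segment-of (x∈p∧x≢y⇒x∈p-y {p = A} c′∈A c′≢d))

  slave-injective : ∀ {X A c d y} → Slave M X A → ∣ X ∣ ≡ 3 → c ∈ A → d ∈ A →
                    E c y ≡ true → E d y ≡ true → c ≡ d
  slave-injective {X} {A} (∣A∣≡3 , _ , SA≡X) ∣X∣≡3 =
    SImage-injective (ℕ.≤-reflexive (trans ∣A∣≡3 (trans (sym ∣X∣≡3) (cong ∣_∣ (sym SA≡X)))))

module _ {n} {M : Structure n} (π : Permutation′ n) (aut : IsAutomorphism M π) where
  open Structure M

  E-invariant : ∀ x y → E (π ⟨$⟩ʳ x) (π ⟨$⟩ʳ y) ≡ E x y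
  E-invariant = proj₁ aut

  T-invariant : ∀ h → T (imageₛ π h) ≡ T h
  T-invariant = proj₁ (proj₂ aut)

  Lt-invariant : ∀ x y → Lt (π ⟨$⟩ʳ x) (π ⟨$⟩ʳ y) ≡ Lt x y
  Lt-invariant = proj₁ (proj₂ (proj₂ aut))

  Mem-invariant : ∀ x y → Mem (π ⟨$⟩ʳ x) (π ⟨$⟩ʳ y) ≡ Mem x y
  Mem-invariant = proj₂ (proj₂ (proj₂ aut))

  segment-image : ∀ {y} → Segment M y → Segment M (π ⟨$⟩ʳ y)
  segment-image {y} (a , Eay) = π ⟨$⟩ʳ a , trans (E-invariant a y) Eay

  π-monotone : ∀ {a b} → Lt a b ≡ true → Lt (π ⟨$⟩ʳ a) (π ⟨$⟩ʳ b) ≡ true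
  π-monotone {a} {b} = trans (Lt-invariant a b)

  module _ (M3 : Is3Multipede M) where
    open Is3Multipede M3

    _≺_ : Rel (Fin n) 0ℓ
    a ≺ b = Lt a b ≡ true

    ≺-trans : Transitive _≺_
    ≺-trans = lt-trans _ _ _

    ≺-irrefl : Irreflexive _≡_ _≺_
    ≺-irrefl refl = lt-irrefl _

    segments-fixed : ∀ {y} → Segment M y → π ⟨$⟩ʳ y ≡ y
    segments-fixed {y} y-seg with lt-total y (π ⟨$⟩ʳ y) y-seg (segment-image y-seg)
    ... | inj₁ y≺πy = ⊥-elim (¬x≺fx ≺-trans ≺-irrefl (π ⟨$⟩ʳ_) π-monotone y y≺πy)
    ... | inj₂ (inj₁ y≡πy) = sym y≡πy
    ... | inj₂ (inj₂ πy≺y) =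
      ⊥-elim (¬x≺fx (flip ≺-trans) (≺-irrefl ∘ sym) (π ⟨$⟩ʳ_) π-monotone y πy≺y)

  module _ (M2 : Is2Multipede M) (π-fixes-segments : ∀ {y} → Segment M y → π ⟨$⟩ʳ y ≡ y) where
    open Is2Multipede M2

    foot-image : ∀ {a y} → E a y ≡ true → E (π ⟨$⟩ʳ a) y ≡ true
    foot-image {a} {y} Eay = begin
      E (π ⟨$⟩ʳ a) y             ≡⟨ cong (E _) (sym (π-fixes-segments (a , Eay))) ⟩
      E (π ⟨$⟩ʳ a) (π ⟨$⟩ʳ y)   ≡⟨ E-invariant a y ⟩
      E a y                       ≡⟨ Eay ⟩
      true                        ∎
      where open ≡-Reasoning

    foot-preimage : ∀ {a y} → E a y ≡ true → E (π ⟨$⟩ˡ a) y ≡ true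
    foot-preimage {a} {y} Eay = begin
      E (π ⟨$⟩ˡ a) y                         ≡⟨ sym (E-invariant (π ⟨$⟩ˡ a) y) ⟩
      E (π ⟨$⟩ʳ (π ⟨$⟩ˡ a)) (π ⟨$⟩ʳ y)     ≡⟨ cong₂ E (inverseʳ π) (π-fixes-segments (a , Eay)) ⟩
      E a y                                   ≡⟨ Eay ⟩
      true                                    ∎
      where open ≡-Reasoning

    Moved : Subset n
    Moved = tabulate λ y → any (λ a → E a y ∧ isNo (π ⟨$⟩ʳ a ≟ a)) (allFin n)

    ∈-Moved⁺ : ∀ {a y} → E a y ≡ true → π ⟨$⟩ʳ a ≢ a → y ∈ Moved
    ∈-Moved⁺ {a} {y} Eay πa≢a = lookup⇒[]= y Moved (trans (lookup∘tabulate _ y)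
      (any-allFin⁺ (λ a → E a y ∧ isNo (π ⟨$⟩ʳ a ≟ a))
        (cong₂ _∧_ Eay (Equivalence.to T-≡ (fromWitnessFalse {a? = π ⟨$⟩ʳ a ≟ a} πa≢a)))))

    ∈-Moved⁻ : ∀ {y} → y ∈ Moved → ∃ λ a → E a y ≡ true × π ⟨$⟩ʳ a ≢ a
    ∈-Moved⁻ {y} y∈Moved =
      let a , Eay∧a-moved = any-allFin⁻ _ (trans (sym (lookup∘tabulate _ y)) ([]=⇒lookup y∈Moved))
          Eay , a-moved = ∧-true⁻ Eay∧a-moved
      in a , Eay , toWitnessFalse {a? = π ⟨$⟩ʳ a ≟ a} (Equivalence.from T-≡ a-moved)

    Moved-segments : AllSegments M Moved
    Moved-segments y y∈Moved =
      let a , Eay , _ = ∈-Moved⁻ (lookup⇒[]= y Moved y∈Moved) in a , Eay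

    Moved-moves-every-foot : ∀ {c y} → y ∈ Moved → E c y ≡ true → π ⟨$⟩ʳ c ≢ c
    Moved-moves-every-foot {c} y∈Moved Ecy πc≡c
      with a , Eay , πa≢a ← ∈-Moved⁻ y∈Moved
      with feet-of-segment M2 Eay (foot-image Eay) (πa≢a ∘ sym) Ecy
    ... | inj₁ refl = πa≢a πc≡c
    ... | inj₂ refl = πa≢a (⟨$⟩ʳ-injective π πc≡c)

    slave-image : ∀ {X A} → Slave M X A → Slave M X (imageₛ π A)
    slave-image {X} {A} (∣A∣≡3 , A-feet , SA≡X) =
      trans (∣imageₛ∣≡∣p∣ π A) ∣A∣≡3 , πA-feet , trans (⊆-antisym SπA⊆SA SA⊆SπA) SA≡X
      where
      πA-feet : AllFeet M (imageₛ π A)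
      πA-feet x x∈πA =
        let y , Eπ⁻¹xy = A-feet _ ([]=⇒lookup (∈-imageₛ⁻ π A (lookup⇒[]= x _ x∈πA)))
        in y , subst (λ z → E z y ≡ true) (inverseʳ π) (foot-image Eπ⁻¹xy)
      SπA⊆SA : SImage M (imageₛ π A) ⊆ SImage M A
      SπA⊆SA y∈SπA with c , c∈πA , Ecy ← ∈-SImage⁻ M (imageₛ π A) y∈SπA =
        ∈-SImage⁺ M (∈-imageₛ⁻ π A c∈πA) (foot-preimage Ecy)
      SA⊆SπA : SImage M A ⊆ SImage M (imageₛ π A)
      SA⊆SπA y∈SA with c , c∈A , Ecy ← ∈-SImage⁻ M A y∈SA =
        ∈-SImage⁺ M (∈-imageₛ⁺ π A c∈A) (foot-image Ecy)

    foot-leaves⇒moved : ∀ {A c y} → c ∈ A → E c y ≡ true → c ∉ imageₛ π A → y ∈ Moved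
    foot-leaves⇒moved {A} {c} c∈A Ecy c∉πA = ∈-Moved⁺ (foot-preimage Ecy) π⁻¹c-moved
      where
      π⁻¹c-moved : π ⟨$⟩ʳ (π ⟨$⟩ˡ c) ≢ π ⟨$⟩ˡ c
      π⁻¹c-moved ππ⁻¹c≡π⁻¹c = c∉πA (subst (_∈ imageₛ π A) πc≡c (∈-imageₛ⁺ π A c∈A))
        where
        πc≡c : π ⟨$⟩ʳ c ≡ c
        πc≡c = trans (cong (π ⟨$⟩ʳ_) (trans (sym (inverseʳ π)) ππ⁻¹c≡π⁻¹c)) (inverseʳ π)

    module _ {X A} (A-slave : Slave M X A) (∣X∣≡3 : ∣ X ∣ ≡ 3) where

      moved⇒foot-leaves : ∀ {c y} → c ∈ A → E c y ≡ true → y ∈ Moved → c ∉ imageₛ π A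
      moved⇒foot-leaves {c} c∈A Ecy y∈Moved c∈πA = Moved-moves-every-foot y∈Moved Ecy πc≡c
        where
        π⁻¹c≡c : π ⟨$⟩ˡ c ≡ c
        π⁻¹c≡c = slave-injective M2 A-slave ∣X∣≡3 (∈-imageₛ⁻ π A c∈πA) c∈A (foot-preimage Ecy) Ecy
        πc≡c : π ⟨$⟩ʳ c ≡ c
        πc≡c = trans (cong (π ⟨$⟩ʳ_) (sym π⁻¹c≡c)) (inverseʳ π)

      fixed-slave⇒X∩Moved≡⊥ : imageₛ π A ≡ A → X ∩ Moved ≡ ⊥
      fixed-slave⇒X∩Moved≡⊥ πA≡A = Empty-unique λ (y , y∈X∩Moved) →
        let y∈X , y∈Moved = x∈p∩q⁻ X Moved y∈X∩Moved
            c , c∈A , Ecy = slave-foot M A-slave y∈X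
        in moved⇒foot-leaves c∈A Ecy y∈Moved (subst (c ∈_) (sym πA≡A) c∈A)

      flipped-segment∈X∩Moved : ∀ {y} → Segment M y →
        (∀ {c} → E c y ≡ true → lookup (imageₛ π A) c ≡ not (lookup A c)) → y ∈ X ∩ Moved
      flipped-segment∈X∩Moved {y} (α , Eαy) flips = x∈p∩q⁺ (y∈X , y∈Moved)
        where
        y∈X : y ∈ X
        y∈X with lookup A α in Aα
        ... | true = slave-segment M A-slave (lookup⇒[]= α A Aα) Eαy
        ... | false = slave-segment M (slave-image {A = A} A-slave)
                        (lookup⇒[]= α (imageₛ π A) (trans (flips Eαy) (cong not Aα))) Eαy
        y∈Moved : y ∈ Moved
        y∈Moved =
          let c , c∈A , Ecy = slave-foot M A-slave y∈X
          in foot-leaves⇒moved {A} c∈A Ecy λ c∈πA →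
               not-¬ ([]=⇒lookup c∈πA) (trans (flips Ecy) (cong not ([]=⇒lookup c∈A)))

      swapped-slave⇒∣X∩Moved∣≡2 : SwapTwo M A (imageₛ π A) → ∣ X ∩ Moved ∣ ≡ 2
      swapped-slave⇒∣X∩Moved∣≡2 (y₁ , y₂ , y₁-seg , y₂-seg , y₁≢y₂ , swap) =
        trans (cong ∣_∣ (⊆-antisym X∩Moved⊆pair pair⊆X∩Moved)) (∣⁅x⁆∪⁅y⁆∣≡2 y₁≢y₂)
        where
        flips-at : ∀ {c} → E c y₁ ∨ E c y₂ ≡ true → lookup (imageₛ π A) c ≡ not (lookup A c)
        flips-at {c} hit = trans (swap c) (trans (cong (lookup A c xor_) hit) (xor-comm _ true))

        pair⊆X∩Moved : ⁅ y₁ ⁆ ∪ ⁅ y₂ ⁆ ⊆ X ∩ Moved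
        pair⊆X∩Moved y∈pair with x∈p∪q⁻ ⁅ y₁ ⁆ ⁅ y₂ ⁆ y∈pair
        ... | inj₁ y∈⁅y₁⁆ rewrite x∈⁅y⁆⇒x≡y y₁ y∈⁅y₁⁆ =
          flipped-segment∈X∩Moved y₁-seg λ {c} Ecy₁ → flips-at (cong (_∨ E c y₂) Ecy₁)
        ... | inj₂ y∈⁅y₂⁆ rewrite x∈⁅y⁆⇒x≡y y₂ y∈⁅y₂⁆ =
          flipped-segment∈X∩Moved y₂-seg λ {c} Ecy₂ →
            flips-at (trans (cong (E c y₁ ∨_) Ecy₂) (∨-zeroʳ (E c y₁)))

        X∩Moved⊆pair : X ∩ Moved ⊆ ⁅ y₁ ⁆ ∪ ⁅ y₂ ⁆
        X∩Moved⊆pair y∈X∩Moved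
          with y∈X , y∈Moved ← x∈p∩q⁻ X Moved y∈X∩Moved
          with c , c∈A , Ecy ← slave-foot M A-slave y∈X =
          let c∉πA = moved⇒foot-leaves c∈A Ecy y∈Moved
          in x∈p∪q⁺ (Sum.map (at Ecy) (at Ecy) (∨-true⁻ (leaving-foot-hits c∈A c∉πA)))
          where
          at : ∀ {c y z} → E c y ≡ true → E c z ≡ true → y ∈ ⁅ z ⁆
          at {c} {y} {z} Ecy Ecz = subst (_∈ ⁅ z ⁆) (foot-one-edge c z y Ecz Ecy) (x∈⁅x⁆ z)
          leaving-foot-hits : ∀ {c} → c ∈ A → c ∉ imageₛ π A → E c y₁ ∨ E c y₂ ≡ true
          leaving-foot-hits {c} c∈A c∉πA = not-injective (begin
            not (E c y₁ ∨ E c y₂)                ≡⟨ cong (_xor (E c y₁ ∨ E c y₂)) ([]=⇒lookup c∈A) ⟨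
            lookup A c xor (E c y₁ ∨ E c y₂)     ≡⟨ swap c ⟨
            lookup (imageₛ π A) c                ≡⟨ ¬-not (c∉πA ∘ lookup⇒[]= c _) ⟩
            not true                             ∎)
            where open ≡-Reasoning

      equivalent-image⇒Moved-meets-evenly : SlaveEquiv M A (imageₛ π A) →
                                             ∣ X ∩ Moved ∣ ≡ 0 ⊎ ∣ X ∩ Moved ∣ ≡ 2
      equivalent-image⇒Moved-meets-evenly (inj₁ A≡πA) =
        inj₁ (trans (cong ∣_∣ (fixed-slave⇒X∩Moved≡⊥ (sym A≡πA))) (∣⊥∣≡0 n))
      equivalent-image⇒Moved-meets-evenly (inj₂ swapped) = inj₂ (swapped-slave⇒∣X∩Moved∣≡2 swapped)

    Moved-meets-evenly : ∀ {X} → SegmentHyperedge M X → ∣ X ∩ Moved ∣ ≡ 0 ⊎ ∣ X ∩ Moved ∣ ≡ 2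
    Moved-meets-evenly {X} X-hyp@(X-edge , _)
      with A , _ , _ , _ , (A-slave , A-positive) , _ ← four-positive X X-hyp =
      equivalent-image⇒Moved-meets-evenly A-slave (proj₁ (hyperedge-shape X X-edge))
        (positive-equiv X X-hyp A (imageₛ π A) A-slave A-positive
          (slave-image {A = A} A-slave) (trans (T-invariant A) A-positive))

    Moved-empty : Odd M → Empty Moved
    Moved-empty odd Moved≢∅ =
      let X , X-hyp , ∣X∩Moved∣-odd = odd Moved Moved-segments Moved≢∅
      in even⇒¬odd (Moved-meets-evenly X-hyp) ∣X∩Moved∣-odd
      where
      even⇒¬odd : ∀ {k} → k ≡ 0 ⊎ k ≡ 2 → k % 2 ≢ 1
      even⇒¬odd (inj₁ refl) ()
      even⇒¬odd (inj₂ refl) ()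

    feet-fixed : Odd M → ∀ {a} → Foot M a → π ⟨$⟩ʳ a ≡ a
    feet-fixed odd {a} (y , Eay) =
      decidable-stable (π ⟨$⟩ʳ a ≟ a) λ πa≢a → Moved-empty odd (y , ∈-Moved⁺ Eay πa≢a)

  module _ (M4 : Is4Multipede M) (odd : Odd M) where
    open Is4Multipede M4
    open Is3Multipede is3

    U₀-fixed : ∀ {x} → InU0 M x → π ⟨$⟩ʳ x ≡ x
    U₀-fixed (inj₁ x-foot) = feet-fixed is2 (segments-fixed is3) odd x-foot
    U₀-fixed (inj₂ x-seg) = segments-fixed is3 x-seg

    Mem-image : ∀ x σ → Mem x (π ⟨$⟩ʳ σ) ≡ Mem x σ
    Mem-image x σ = ≡-by-true-cases (segment-Mem ∘ proj₁ ∘ mem-typed x (π ⟨$⟩ʳ σ))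
                                     (segment-Mem ∘ proj₁ ∘ mem-typed x σ)
      where
      segment-Mem : Segment M x → Mem x (π ⟨$⟩ʳ σ) ≡ Mem x σ
      segment-Mem x-seg =
        trans (cong (λ z → Mem z (π ⟨$⟩ʳ σ)) (sym (segments-fixed is3 x-seg))) (Mem-invariant x σ)

lemma4p4 : (n : ℕ) (M : Structure n) → Is4Multipede M → Odd M → Rigid M
lemma4p4 n M M4 odd π aut x with InU0? M x | InU0? M (π ⟨$⟩ʳ x)
... | yes x∈U₀ | _ = U₀-fixed π aut M4 odd x∈U₀
... | no _ | yes πx∈U₀ = ⟨$⟩ʳ-injective π (U₀-fixed π aut M4 odd πx∈U₀)
... | no x∉U₀ | no πx∉U₀ =
  Is4Multipede.mem-injective M4 (π ⟨$⟩ʳ x) x πx∉U₀ x∉U₀ (λ y → Mem-image π aut M4 odd y x)
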